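{- Let $d\ge t$ be positive integers such that $\operatorname{lcm}(d_A,t_A)$ is either $1$, a prime power, or twice a prime power. (i) If $\operatorname{lcm}(d_A,t_A)=1$, then $d=t$. (ii) If $\operatorname{lcm}(d_A,t_A)=q^a$ for some prime $q$ and $a>0$, then $d=q^{a-x}t$ for some $x<a$. (iii) If $\operatorname{lcm}(d_A,t_A)=2q^a$ for some $a>0$ and odd prime $q$, then precisely one of $d,t$ is even; moreover $d=2q^{a-x}t$ if $d$ is even, and $d=q^{a-x}\frac{t}{2}$ otherwise, for some $x<a$.
   Context: $A_{d,t}=\{q\text{ prime}: v_q(d)=v_q(t)>0\}$, where $v_q$ is the $q$-adic valuation. $d_A$ (resp. $t_A$) is the maximal divisor of $d$ (resp. $t$) not divisible by any prime in $A_{d,t}$. -}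

module Defs where

open import Data.Nat using (ℕ; suc; _^_; _<_; _≤_)
open import Data.Nat.Divisibility using (_∣_)
open import Data.Nat.Primality using (Prime)
open import Data.Product using (Σ; _×_)
open import Relation.Nullary using (¬_)

HasValuation : ℕ → ℕ → ℕ → Set
HasValuation q n k = (q ^ k ∣ n) × ¬ (q ^ suc k ∣ n)

InA : ℕ → ℕ → ℕ → Set
InA d t q = Prime q × Σ ℕ (λ k → (0 < k) × HasValuation q d k × HasValuation q t k)

GoodDivisor : ℕ → ℕ → ℕ → ℕ → Set
GoodDivisor d t n m = (m ∣ n) × ((q : ℕ) → InA d t q → ¬ (q ∣ m))

-- m is the maximal divisor of n not divisible by any prime of A_{d,t}
-- (so m = d_A when n = d, m = t_A when n = t)
IsMaxA : ℕ → ℕ → ℕ → ℕ → Set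
IsMaxA d t n m = GoodDivisor d t n m × ((m' : ℕ) → GoodDivisor d t n m' → m' ≤ m)

module Submission where

-- Proposition 4.11.  Write d = P * d_A and t = P' * t_A.  The cofactors P and
-- P' both have valuation v_q(d) = v_q(t) at primes q ∈ A_{d,t} (since d_A and
-- t_A avoid A) and valuation 0 elsewhere (a prime outside A could be moved
-- into the maximal divisor d_A or t_A); by unique factorisation P = P'.  So
-- d = P * d_A and t = P * t_A for one P built from primes of A, and t ≤ d
-- gives t_A ≤ d_A.  The three cases then only concern the two divisors
-- d_A, t_A of lcm(d_A, t_A): they are powers q^b, q^c (times 2 in case (iii));
-- the lcm and t_A ≤ d_A force the larger one to carry q^a, and d_A, t_A
-- cannot carry the same exact positive power of a prime, as it would lie in A.

open import Defs
open import Data.Empty using (⊥; ⊥-elim)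
open import Data.List using ([]; _∷_)
open import Data.List.Relation.Unary.All using (_∷_)
open import Data.Nat
open import Data.Nat.Coprimality using (Coprime; coprime-divisor) renaming (sym to coprime-sym)
open import Data.Nat.Divisibility
open import Data.Nat.Induction using (<-wellFounded)
open import Data.Nat.LCM using (lcm; m∣lcm[m,n]; n∣lcm[m,n]; lcm-least)
open import Data.Nat.ListAction using (product)
open import Data.Nat.Primality
open import Data.Nat.Primality.Factorisation using (factorise)
open import Data.Nat.Properties
open import Algebra.Properties.CommutativeSemigroup *-commutativeSemigroup using (x∙yz≈y∙xz)
open import Data.Product
open import Data.Sum using (_⊎_; inj₁; inj₂; [_,_]′)
open import Induction.WellFounded using (Acc; acc)
open import Relation.Binary.Definitions using (tri<; tri≈; tri>)
open import Relation.Binary.PropositionalEquality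
open import Relation.Nullary using (¬_; Dec; yes; no)

private
  variable
    p q r m n k j a b c nA P R S : ℕ

prime>1 : Prime p → 1 < p
prime>1 {p} (prime _) = nonTrivial⇒n>1 p

prime∤1 : Prime p → ¬ p ∣ 1
prime∤1 pp p∣1 = <⇒≢ (prime>1 pp) (sym (∣1⇒≡1 p∣1))

prime∤* : Prime p → ¬ p ∣ m → ¬ p ∣ n → ¬ p ∣ m * n
prime∤* {m = m} {n} pp p∤m p∤n p∣mn = [ p∤m , p∤n ]′ (euclidsLemma m n pp p∣mn)

prime∣^⇒∣ : ∀ k → Prime p → p ∣ n ^ k → p ∣ n
prime∣^⇒∣ zero    pp p∣1 = ⊥-elim (prime∤1 pp p∣1)
prime∣^⇒∣ {n = n} (suc k) pp p∣n^[1+k] with euclidsLemma n (n ^ k) pp p∣n^[1+k]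
... | inj₁ p∣n   = p∣n
... | inj₂ p∣n^k = prime∣^⇒∣ k pp p∣n^k

prime∤prime : Prime r → Prime p → r ≢ p → ¬ r ∣ p
prime∤prime pr pp r≢p r∣p with prime⇒irreducible pp r∣p
... | inj₁ r≡1 = <⇒≢ (prime>1 pr) (sym r≡1)
... | inj₂ r≡p = r≢p r≡p

prime-divisor : 1 < n → ∃[ p ] Prime p × p ∣ n
prime-divisor {n@(suc _)} 1<n with factorise n
... | record { factors = [] ; isFactorisation = n≡1 } = ⊥-elim (<⇒≢ 1<n (sym n≡1))
... | record { factors = p ∷ ps ; isFactorisation = n≡pΠ ; factorsPrime = pp ∷ _ } =
  p , pp , subst (p ∣_) (sym n≡pΠ) (m∣m*n (product ps))

prime-power-cancel : ∀ k → Prime p → ¬ p ∣ m → p ^ k ∣ m * n → p ^ k ∣ n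
prime-power-cancel zero pp p∤m _ = 1∣ _
prime-power-cancel {p} {m} {n} (suc k) pp p∤m p^[1+k]∣mn
  with euclidsLemma m n pp (∣-trans (m∣m*n (p ^ k)) p^[1+k]∣mn)
... | inj₁ p∣m = ⊥-elim (p∤m p∣m)
... | inj₂ (divides n′ refl) =
  subst (p * p ^ k ∣_) (*-comm p n′) (*-monoʳ-∣ p (prime-power-cancel k pp p∤m p^k∣mn′))
  where
    instance
      p≢0 : NonZero p
      p≢0 = prime⇒nonZero pp
    p^k∣mn′ : p ^ k ∣ m * n′
    p^k∣mn′ = *-cancelˡ-∣ p (subst (p * p ^ k ∣_) mpn′≡pmn′ p^[1+k]∣mn)
      where mpn′≡pmn′ = trans (sym (*-assoc m n′ p)) (*-comm (m * n′) p)

factor-positive : ∀ m {n} → 0 < m * n → 0 < m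
factor-positive m {n} 0<mn = >-nonZero⁻¹ m {{m*n≢0⇒m≢0 m {{>-nonZero 0<mn}}}}

p^1≡p : ∀ p → p ^ 1 ≡ p
p^1≡p = *-identityʳ

^-∣-mono : ∀ p {m n} → m ≤ n → p ^ m ∣ p ^ n
^-∣-mono p {m} {n} m≤n =
  subst (p ^ m ∣_) (trans (sym (^-distribˡ-+-* p m (n ∸ m))) (cong (p ^_) (m+[n∸m]≡n m≤n)))
        (m∣m*n (p ^ (n ∸ m)))

valuation-zero : ¬ p ∣ n → HasValuation p n 0
valuation-zero {p} p∤n = 1∣ _ , λ p^1∣n → p∤n (subst (_∣ _) (p^1≡p p) p^1∣n)

valuation-unique : HasValuation p n k → HasValuation p n j → k ≡ j
valuation-unique {p} {n} {k} {j} (p^k∣n , p^k+1∤n) (p^j∣n , p^j+1∤n) with <-cmp k j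
... | tri< k<j _ _ = ⊥-elim (p^k+1∤n (∣-trans (^-∣-mono p k<j) p^j∣n))
... | tri≈ _ k≡j _ = k≡j
... | tri> _ _ j<k = ⊥-elim (p^j+1∤n (∣-trans (^-∣-mono p j<k) p^k∣n))

valuation>0⇒∣ : 0 < k → HasValuation p n k → p ∣ n
valuation>0⇒∣ {suc k} {p} _ (p^k+1∣n , _) = ∣-trans (m∣m*n (p ^ k)) p^k+1∣n

valuation-*-self : ∀ {p n k} .{{_ : NonZero p}} →
                   HasValuation p n k → HasValuation p (p * n) (suc k)
valuation-*-self {p} (p^k∣n , p^k+1∤n) =
  *-monoʳ-∣ p p^k∣n , λ p^k+2∣pn → p^k+1∤n (*-cancelˡ-∣ p p^k+2∣pn)

valuation-/-self : ∀ {p n k} .{{_ : NonZero p}} →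
                   HasValuation p (p * n) (suc k) → HasValuation p n k
valuation-/-self {p} (p^k+1∣pn , p^k+2∤pn) =
  *-cancelˡ-∣ p p^k+1∣pn , λ p^k+1∣n → p^k+2∤pn (*-monoʳ-∣ p p^k+1∣n)

valuation-*-other : Prime r → Prime p → r ≢ p →
                    HasValuation r n k → HasValuation r (p * n) k
valuation-*-other {r} {p} {n} {k} pr pp r≢p (r^k∣n , r^k+1∤n) =
  ∣n⇒∣m*n p r^k∣n ,
  λ r^k+1∣pn → r^k+1∤n (prime-power-cancel (suc k) pr (prime∤prime pr pp r≢p) r^k+1∣pn)

valuation-/-other : Prime r → Prime p → r ≢ p →
                    HasValuation r (p * n) k → HasValuation r n k
valuation-/-other {r} {p} {n} {k} pr pp r≢p (r^k∣pn , r^k+1∤pn) =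
  prime-power-cancel k pr (prime∤prime pr pp r≢p) r^k∣pn ,
  λ r^k+1∣n → r^k+1∤pn (∣n⇒∣m*n p r^k+1∣n)

valuation-power-* : ∀ b → Prime q → ¬ q ∣ m → HasValuation q (q ^ b * m) b
valuation-power-* {q} {m} zero    pq q∤m =
  subst (λ x → HasValuation q x 0) (sym (*-identityˡ m)) (valuation-zero q∤m)
valuation-power-* {q} {m} (suc b) pq q∤m =
  subst (λ x → HasValuation q x (suc b)) (sym (*-assoc q (q ^ b) m))
        (valuation-*-self {q} {q ^ b * m} {b} {{prime⇒nonZero pq}} (valuation-power-* b pq q∤m))

valuation-exists : Prime p → 0 < n → ∃[ k ] HasValuation p n k
valuation-exists {p} {n} pp 0<n = go n 0<n (<-wellFounded n)
  where
    instance
      p≢0 : NonZero p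
      p≢0 = prime⇒nonZero pp
      p>1 : NonTrivial p
      p>1 = prime⇒nonTrivial pp
    go : ∀ n → 0 < n → Acc _<_ n → ∃[ k ] HasValuation p n k
    go n 0<n (acc smaller) with p ∣? n
    ... | no p∤n = 0 , valuation-zero p∤n
    ... | yes p∣n =
      let e , v = go (quotient p∣n) (factor-positive (quotient p∣n) 0<n/p*p) (smaller (quotient-< p∣n))
      in suc e , subst (λ x → HasValuation p x (suc e)) (sym (m∣n⇒n≡m*quotient p∣n))
                       (valuation-*-self {p} {quotient p∣n} {e} v)
      where
        instance
          n≢0 : NonZero n
          n≢0 = >-nonZero 0<n
        0<n/p*p : 0 < quotient p∣n * p
        0<n/p*p = subst (0 <_) (m∣n⇒n≡quotient*m p∣n) 0<n

infix 4 _≼ᵥ_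
_≼ᵥ_ : ℕ → ℕ → Set
x ≼ᵥ y = ∀ p k → Prime p → HasValuation p x k → HasValuation p y k

≼ᵥ-/-prime : ∀ {x y} → Prime p → p * x ≼ᵥ p * y → x ≼ᵥ y
≼ᵥ-/-prime {p} {x} {y} pp px≼py r j pr v with r ≟ p
... | yes refl = valuation-/-self {p} {y} {j} (px≼py p (suc j) pp (valuation-*-self {p} {x} {j} v))
  where instance
          p≢0 : NonZero p
          p≢0 = prime⇒nonZero pp
... | no r≢p   = valuation-/-other {r} {p} {y} {j} pr pp r≢p
                   (px≼py r j pr (valuation-*-other {r} {p} {x} {j} pr pp r≢p v))

-- Positive numbers are determined by their valuations (unique factorisation):
-- peel off a prime of x, which by the hypothesis also divides y, and recurse.
≼ᵥ⇒≡ : ∀ {x y} → 0 < x → 0 < y → x ≼ᵥ y → x ≡ y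
≼ᵥ⇒≡ {x} 0<x = go x 0<x (<-wellFounded x)
  where
    go : ∀ x {y} → 0 < x → Acc _<_ x → 0 < y → x ≼ᵥ y → x ≡ y
    go 1 {1} _ _ _ _ = refl
    go 1 {y@(suc (suc _))} _ _ _ 1≼y with prime-divisor {y} (s≤s (s≤s z≤n))
    ... | p , pp , p∣y =
      ⊥-elim (proj₂ (1≼y p 0 pp (valuation-zero (prime∤1 pp))) (subst (_∣ y) (sym (p^1≡p p)) p∣y))
    go x@(suc (suc _)) {y} _ (acc smaller) 0<y x≼y with prime-divisor {x} (s≤s (s≤s z≤n))
    ... | p , pp , p∣x = begin
      x      ≡⟨ m∣n⇒n≡m*quotient p∣x ⟩
      p * x′ ≡⟨ cong (p *_) (go x′ 0<x′ (smaller x′<x) 0<y′ x′≼y′) ⟩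
      p * y′ ≡⟨ m∣n⇒n≡m*quotient p∣y ⟨
      y      ∎
      where
        open ≡-Reasoning
        instance
          p≢0 : NonZero p
          p≢0 = prime⇒nonZero pp
          p>1 : NonTrivial p
          p>1 = prime⇒nonTrivial pp
        x′ : ℕ
        x′ = quotient p∣x
        x′<x : x′ < x
        x′<x = quotient-< p∣x
        0<x′ : 0 < x′
        0<x′ = >-nonZero⁻¹ x′ {{quotient≢0 p∣x}}
        -- p divides y, since v_p(x) ≥ 1 is also a valuation of y
        p∣y : p ∣ y
        p∣y with valuation-exists pp 0<x′
        ... | e , v = valuation>0⇒∣ {suc e} z<s (x≼y p (suc e) pp
                        (subst (λ z → HasValuation p z (suc e)) (sym (m∣n⇒n≡m*quotient p∣x))
                               (valuation-*-self {p} {x′} {e} v)))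
        y′ : ℕ
        y′ = quotient p∣y
        0<y′ : 0 < y′
        0<y′ = factor-positive y′ (subst (0 <_) (m∣n⇒n≡quotient*m p∣y) 0<y)
        x′≼y′ : x′ ≼ᵥ y′
        x′≼y′ = ≼ᵥ-/-prime pp (subst₂ _≼ᵥ_ (m∣n⇒n≡m*quotient p∣x) (m∣n⇒n≡m*quotient p∣y) x≼y)

module ExceptionalPrimes (d t : ℕ) (0<d : 0 < d) (0<t : 0 < t) where

  InA? : Prime p → Dec (InA d t p)
  InA? {p} pp with valuation-exists pp 0<d | valuation-exists pp 0<t
  ... | zero , vd | _ = no λ (_ , m , 0<m , vd′ , _) →
          <⇒≢ 0<m (valuation-unique {p} {d} {0} {m} vd vd′)
  ... | k@(suc _) , vd | j , vt with k ≟ j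
  ...   | yes refl = yes (pp , k , z<s , vd , vt)
  ...   | no k≢j   = no λ (_ , m , _ , vd′ , vt′) →
          k≢j (trans (valuation-unique {p} {d} {k} {m} vd vd′) (valuation-unique {p} {t} {m} {j} vt′ vt))

  -- If n = P * n_A with n_A maximal, every prime p ∣ P lies in A_{d,t}:
  -- otherwise p * n_A would be a larger good divisor of n.
  cofactor-prime∈A : IsMaxA d t n nA → n ≡ P * nA → 0 < n → Prime p → p ∣ P → InA d t p
  cofactor-prime∈A {n} {nA} {P} {p} ((_ , good) , maximal) n≡PnA 0<n pp p∣P with InA? pp
  ... | yes p∈A = p∈A
  ... | no  p∉A = ⊥-elim (<⇒≱ nA<pnA (maximal (p * nA) (pnA∣n , pnA-good)))
    where
      instance
        p≢0 : NonZero p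
        p≢0 = prime⇒nonZero pp
      nA≢0 : NonZero nA
      nA≢0 = m*n≢0⇒n≢0 P {{>-nonZero (subst (0 <_) n≡PnA 0<n)}}
      nA<pnA : nA < p * nA
      nA<pnA = subst (nA <_) (*-comm nA p) (m<m*n nA p {{nA≢0}} (prime>1 pp))
      pnA∣n : p * nA ∣ n
      pnA∣n = subst (p * nA ∣_) (sym n≡PnA) (*-monoˡ-∣ nA p∣P)
      pnA-good : ∀ q → InA d t q → ¬ q ∣ p * nA
      pnA-good q q∈A@(pq , _) q∣pnA with euclidsLemma p nA pq q∣pnA
      ... | inj₂ q∣nA = good q q∈A q∣nA
      ... | inj₁ q∣p with prime⇒irreducible pp q∣p
      ...   | inj₁ q≡1 = <⇒≢ (prime>1 pq) (sym q≡1)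
      ...   | inj₂ refl = p∉A q∈A

  -- For p ∈ A the good part n_A is prime to p, so v_p(P) = v_p(n).
  cofactor-valuation : GoodDivisor d t n nA → n ≡ P * nA → InA d t p →
                       HasValuation p n k → HasValuation p P k
  cofactor-valuation {n} {nA} {P} {p} {k} (_ , good) n≡PnA p∈A@(pp , _) (p^k∣n , p^k+1∤n) =
    prime-power-cancel k pp (good p p∈A) (subst (p ^ k ∣_) (trans n≡PnA (*-comm P nA)) p^k∣n) ,
    λ p^k+1∣P → p^k+1∤n (subst (p ^ suc k ∣_) (sym n≡PnA) (∣m⇒∣m*n nA p^k+1∣P))

  -- Both cofactors
  -- have valuation v_p(d) = v_p(t) at p ∈ A and valuation 0 elsewhere.
  common-cofactor : ∀ {dA tA} → IsMaxA d t d dA → IsMaxA d t t tA →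
    ∃[ P ] (d ≡ P * dA) × (t ≡ P * tA) × (∀ p → Prime p → p ∣ P → InA d t p)
  common-cofactor {dA} {tA} Md@((dA∣d , _) , _) Mt@((tA∣t , _) , _) =
    Pd , d≡PdA , subst (λ P → t ≡ P * tA) (sym Pd≡Pt) t≡PttA , primes-of-Pd
    where
      Pd Pt : ℕ
      Pd = quotient dA∣d
      Pt = quotient tA∣t
      d≡PdA : d ≡ Pd * dA
      d≡PdA = m∣n⇒n≡quotient*m dA∣d
      t≡PttA : t ≡ Pt * tA
      t≡PttA = m∣n⇒n≡quotient*m tA∣t
      primes-of-Pd : ∀ p → Prime p → p ∣ Pd → InA d t p
      primes-of-Pd p = cofactor-prime∈A Md d≡PdA 0<d
      primes-of-Pt : ∀ p → Prime p → p ∣ Pt → InA d t p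
      primes-of-Pt p = cofactor-prime∈A Mt t≡PttA 0<t
      -- p ∣ Pd: then p ∈ A and v_p(Pd) = v_p(d) = v_p(t) = v_p(Pt);
      -- p ∤ Pd: then also p ∤ Pt, as otherwise p ∈ A and v_p(Pd) = v_p(d) > 0.
      Pd≼Pt : Pd ≼ᵥ Pt
      Pd≼Pt p k pp v with p ∣? Pd | p ∣? Pt
      ... | yes p∣Pd | _ with primes-of-Pd p pp p∣Pd
      ...   | p∈A@(_ , m , _ , vd , vt) =
              subst (HasValuation p Pt)
                    (valuation-unique {p} {Pd} {m} {k} (cofactor-valuation {k = m} (proj₁ Md) d≡PdA p∈A vd) v)
                    (cofactor-valuation {k = m} (proj₁ Mt) t≡PttA p∈A vt)
      Pd≼Pt p k pp v | no p∤Pd | no p∤Pt =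
              subst (HasValuation p Pt) (valuation-unique {p} {Pd} {0} {k} (valuation-zero p∤Pd) v)
                    (valuation-zero p∤Pt)
      Pd≼Pt p k pp v | no p∤Pd | yes p∣Pt with primes-of-Pt p pp p∣Pt
      ...   | p∈A@(_ , m , 0<m , vd , _) =
              ⊥-elim (p∤Pd (valuation>0⇒∣ {m} 0<m (cofactor-valuation {k = m} (proj₁ Md) d≡PdA p∈A vd)))
      Pd≡Pt : Pd ≡ Pt
      Pd≡Pt = ≼ᵥ⇒≡ (factor-positive Pd (subst (0 <_) d≡PdA 0<d))
                   (factor-positive Pt (subst (0 <_) t≡PttA 0<t)) Pd≼Pt

^-split : ∀ q {a c} → c ≤ a → q ^ a ≡ q ^ (a ∸ c) * q ^ c
^-split q {a} {c} c≤a = trans (cong (q ^_) (sym (m∸n+n≡m c≤a))) (^-distribˡ-+-* q (a ∸ c) c)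

^-reflects-≤ : 1 < q → q ^ m ≤ q ^ n → m ≤ n
^-reflects-≤ {q} {m} {n} 1<q q^m≤q^n with m ≤? n
... | yes m≤n = m≤n
... | no  m≰n = ⊥-elim (<⇒≱ (^-monoʳ-< q 1<q (≰⇒> m≰n)) q^m≤q^n)

^-∣-reflects-≤ : 1 < q → q ^ m ∣ q ^ n → m ≤ n
^-∣-reflects-≤ {q@(suc _)} {m} {n} 1<q q^m∣q^n = ^-reflects-≤ 1<q (∣⇒≤ {{m^n≢0 q n}} q^m∣q^n)

odd-^ : ∀ n → ¬ 2 ∣ q → ¬ 2 ∣ q ^ n
odd-^ n 2∤q 2∣q^n = 2∤q (prime∣^⇒∣ n prime[2] 2∣q^n)

odd-prime≥3 : Prime q → ¬ 2 ∣ q → 3 ≤ q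
odd-prime≥3 {q} pq 2∤q with prime>1 pq
... | s≤s (s≤s {n = q-2} z≤n) with q-2
...   | zero  = ⊥-elim (2∤q ∣-refl)
...   | suc _ = s≤s (s≤s (s≤s z≤n))

^-reflects-≤-doubled : 3 ≤ q → q ^ m ≤ 2 * q ^ n → m ≤ n
^-reflects-≤-doubled {q} {m} {n} 3≤q q^m≤2q^n with m ≤? n
... | yes m≤n = m≤n
... | no  m≰n = ⊥-elim (<⇒≱ 2q^n<q^m q^m≤2q^n)
  where
    instance
      q≢0 : NonZero q
      q≢0 = >-nonZero (≤-trans z<s 3≤q)
      q^n≢0 : NonZero (q ^ n)
      q^n≢0 = m^n≢0 q n
    2q^n<q^m : 2 * q ^ n < q ^ m
    2q^n<q^m = begin-strict
      2 * q ^ n  <⟨ *-monoˡ-< (q ^ n) {2} {3} ≤-refl ⟩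
      3 * q ^ n  ≤⟨ *-monoˡ-≤ (q ^ n) 3≤q ⟩
      q ^ suc n  ≤⟨ ^-monoʳ-≤ q (≰⇒> m≰n) ⟩
      q ^ m      ∎
      where open ≤-Reasoning

^-reflects-<-halved : .{{NonZero q}} → 2 * q ^ m ≤ q ^ n → m < n
^-reflects-<-halved {q} {m} {n} 2q^m≤q^n with m <? n
... | yes m<n = m<n
... | no  m≮n = ⊥-elim (<⇒≱ q^n<2q^m 2q^m≤q^n)
  where
    instance
      q^m≢0 : NonZero (q ^ m)
      q^m≢0 = m^n≢0 q m
    q^n<2q^m : q ^ n < 2 * q ^ m
    q^n<2q^m = begin-strict
      q ^ n      ≤⟨ ^-monoʳ-≤ q (≮⇒≥ m≮n) ⟩
      q ^ m      ≡⟨ *-identityˡ (q ^ m) ⟨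
      1 * q ^ m  <⟨ *-monoˡ-< (q ^ m) {1} {2} ≤-refl ⟩
      2 * q ^ m  ∎
      where open ≤-Reasoning

prime-coprime : Prime p → ¬ p ∣ n → Coprime n p
prime-coprime pp p∤n = coprime-sym coprime
  where
    coprime : Coprime _ _
    coprime (i∣p , i∣n) with prime⇒irreducible pp i∣p
    ... | inj₁ i≡1 = i≡1
    ... | inj₂ refl = ⊥-elim (p∤n i∣n)

∣prime^⇒prime^ : ∀ a → Prime q → m ∣ q ^ a → ∃[ b ] b ≤ a × m ≡ q ^ b
∣prime^⇒prime^ zero pq m∣1 = 0 , z≤n , ∣1⇒≡1 m∣1
∣prime^⇒prime^ {q} {m} (suc a) pq m∣q^[1+a] with q ∣? m
... | no  q∤m with ∣prime^⇒prime^ a pq (coprime-divisor (prime-coprime pq q∤m) m∣q^[1+a])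
...   | b , b≤a , m≡q^b = b , m≤n⇒m≤1+n b≤a , m≡q^b
∣prime^⇒prime^ {q} {m} (suc a) pq m∣q^[1+a] | yes q∣m
  with ∣prime^⇒prime^ a pq (*-cancelˡ-∣ q {{prime⇒nonZero pq}}
                              (subst (_∣ q ^ suc a) (m∣n⇒n≡m*quotient q∣m) m∣q^[1+a]))
...   | b , b≤a , m/q≡q^b = suc b , s≤s b≤a , trans (m∣n⇒n≡m*quotient q∣m) (cong (q *_) m/q≡q^b)

∣2*prime^⇒ : ∀ a → Prime q → m ∣ 2 * q ^ a → ∃[ b ] b ≤ a × (m ≡ q ^ b ⊎ m ≡ 2 * q ^ b)
∣2*prime^⇒ {q} {m} a pq m∣2q^a with 2 ∣? m
... | no  2∤m with ∣prime^⇒prime^ a pq (coprime-divisor (prime-coprime prime[2] 2∤m) m∣2q^a)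
...   | b , b≤a , m≡q^b = b , b≤a , inj₁ m≡q^b
∣2*prime^⇒ {q} {m} a pq m∣2q^a | yes 2∣m
  with ∣prime^⇒prime^ a pq (*-cancelˡ-∣ {quotient 2∣m} 2
                              (subst (_∣ 2 * q ^ a) (m∣n⇒n≡m*quotient 2∣m) m∣2q^a))
...   | b , b≤a , m/2≡q^b = b , b≤a , inj₂ (trans (m∣n⇒n≡m*quotient 2∣m) (cong (2 *_) m/2≡q^b))

exponent-pinned : 1 < q → b ≤ a → q ^ a ∣ q ^ b → b ≡ a
exponent-pinned 1<q b≤a q^a∣q^b = ≤-antisym b≤a (^-∣-reflects-≤ 1<q q^a∣q^b)

module Decomposed {d t P dA tA : ℕ} (0<t : 0 < t) (t≤d : t ≤ d)
  (d≡PdA : d ≡ P * dA) (t≡PtA : t ≡ P * tA)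
  (goodD : ∀ q → InA d t q → ¬ q ∣ dA) (goodT : ∀ q → InA d t q → ¬ q ∣ tA)
  (primes-of-P : ∀ q → Prime q → q ∣ P → InA d t q) where

  open ≡-Reasoning

  instance
    P≢0 : NonZero P
    P≢0 = >-nonZero (factor-positive P (subst (0 <_) t≡PtA 0<t))

  ∣dA⇒∤P : Prime q → q ∣ dA → ¬ q ∣ P
  ∣dA⇒∤P pq q∣dA q∣P = goodD _ (primes-of-P _ pq q∣P) q∣dA

  ∣tA⇒∤P : Prime q → q ∣ tA → ¬ q ∣ P
  ∣tA⇒∤P pq q∣tA q∣P = goodT _ (primes-of-P _ pq q∣P) q∣tA

  tA≤dA : tA ≤ dA
  tA≤dA = *-cancelˡ-≤ P (subst₂ _≤_ t≡PtA d≡PdA t≤d)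

  -- d_A and t_A never contain exactly the same positive power of a prime q:
  -- then q ∤ P and v_q(d) = v_q(t) = a, so q ∈ A although q ∣ d_A.
  no-common-exact-power : Prime q → 0 < a → dA ≡ q ^ a * R → tA ≡ q ^ a * S →
                          ¬ q ∣ R → ¬ q ∣ S → ⊥
  no-common-exact-power {q} {a} {R} {S} pq 0<a dA≡q^aR tA≡q^aS q∤R q∤S =
    goodD q (pq , a , 0<a , valuation-of d≡PdA dA≡q^aR q∤R , valuation-of t≡PtA tA≡q^aS q∤S) q∣dA
    where
      q∣dA : q ∣ dA
      q∣dA = subst (q ∣_) (sym dA≡q^aR)
                   (∣m⇒∣m*n R (subst (_∣ q ^ a) (p^1≡p q) (^-∣-mono q 0<a)))
      q∤P : ¬ q ∣ P
      q∤P = ∣dA⇒∤P pq q∣dA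
      valuation-of : ∀ {n nA T} → n ≡ P * nA → nA ≡ q ^ a * T → ¬ q ∣ T → HasValuation q n a
      valuation-of {n} {nA} {T} n≡PnA nA≡q^aT q∤T =
        subst (λ x → HasValuation q x a) (sym n≡q^a[PT]) (valuation-power-* a pq (prime∤* pq q∤P q∤T))
        where
          n≡q^a[PT] : n ≡ q ^ a * (P * T)
          n≡q^a[PT] = trans n≡PnA (trans (cong (P *_) nA≡q^aT) (x∙yz≈y∙xz P (q ^ a) T))

  dA∣lcm : dA ∣ lcm dA tA
  dA∣lcm = m∣lcm[m,n] dA tA

  tA∣lcm : tA ∣ lcm dA tA
  tA∣lcm = n∣lcm[m,n] dA tA

  shift-exponent : ∀ q → c ≤ a → P * q ^ a ≡ q ^ (a ∸ c) * (P * q ^ c)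
  shift-exponent {c} {a} q c≤a = trans (cong (P *_) (^-split q c≤a)) (x∙yz≈y∙xz P (q ^ (a ∸ c)) (q ^ c))

  -- (i) lcm(d_A, t_A) = 1 forces d_A = t_A = 1.
  part-i : lcm dA tA ≡ 1 → d ≡ t
  part-i L = begin
    d       ≡⟨ d≡PdA ⟩
    P * dA  ≡⟨ cong (P *_) (trans (≡1 dA∣lcm) (sym (≡1 tA∣lcm))) ⟩
    P * tA  ≡⟨ t≡PtA ⟨
    t       ∎
    where
      ≡1 : ∀ {n} → n ∣ lcm dA tA → n ≡ 1
      ≡1 n∣lcm = ∣1⇒≡1 (subst (_ ∣_) L n∣lcm)

  -- (ii) d_A = q ^ b, t_A = q ^ c with c ≤ b (as t ≤ d); the lcm forces b = a,
  -- and c = a is excluded since then q ∈ A.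
  part-ii : Prime q → 0 < a → lcm dA tA ≡ q ^ a → ∃[ x ] x < a × d ≡ q ^ (a ∸ x) * t
  part-ii {q} {a} pq 0<a L
    with ∣prime^⇒prime^ a pq (subst (dA ∣_) L dA∣lcm) | ∣prime^⇒prime^ a pq (subst (tA ∣_) L tA∣lcm)
  ... | b , b≤a , dA≡q^b | c , c≤a , tA≡q^c = c , c<a , d≡q^[a-c]t
    where
      c≤b : c ≤ b
      c≤b = ^-reflects-≤ (prime>1 pq) (subst₂ _≤_ tA≡q^c dA≡q^b tA≤dA)
      lcm∣q^b : lcm dA tA ∣ q ^ b
      lcm∣q^b = lcm-least (∣-reflexive dA≡q^b) (subst (_∣ q ^ b) (sym tA≡q^c) (^-∣-mono q c≤b))
      dA≡q^a : dA ≡ q ^ a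
      dA≡q^a = trans dA≡q^b (cong (q ^_) (exponent-pinned (prime>1 pq) b≤a (subst (_∣ q ^ b) L lcm∣q^b)))
      c<a : c < a
      c<a = ≤∧≢⇒< c≤a λ { refl →
        no-common-exact-power pq 0<a (trans dA≡q^a (sym (*-identityʳ _))) (trans tA≡q^c (sym (*-identityʳ _)))
                              (prime∤1 pq) (prime∤1 pq) }
      d≡q^[a-c]t : d ≡ q ^ (a ∸ c) * t
      d≡q^[a-c]t = begin
        d                          ≡⟨ d≡PdA ⟩
        P * dA                     ≡⟨ cong (P *_) dA≡q^a ⟩
        P * q ^ a                  ≡⟨ shift-exponent q c≤a ⟩
        q ^ (a ∸ c) * (P * q ^ c)  ≡⟨ cong (λ x → q ^ (a ∸ c) * (P * x)) tA≡q^c ⟨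
        q ^ (a ∸ c) * (P * tA)     ≡⟨ cong (q ^ (a ∸ c) *_) t≡PtA ⟨
        q ^ (a ∸ c) * t            ∎

  -- (iii), case d_A = 2 q ^ b, t_A = q ^ c: d is even, t odd (as P is odd),
  -- c ≤ b since t ≤ d and q ≥ 3, and the lcm forces b = a.
  even-case : Prime q → ¬ 2 ∣ q → 0 < a → lcm dA tA ≡ 2 * q ^ a → b ≤ a → c ≤ a →
              dA ≡ 2 * q ^ b → tA ≡ q ^ c →
              (2 ∣ d × ¬ 2 ∣ t) × ∃[ x ] x < a × d ≡ 2 * q ^ (a ∸ x) * t
  even-case {q} {a} {b} {c} pq 2∤q 0<a L b≤a c≤a dA≡2q^b tA≡q^c = (2∣d , 2∤t) , c , c<a , d≡2q^[a-c]t
    where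
      2∣dA : 2 ∣ dA
      2∣dA = subst (2 ∣_) (sym dA≡2q^b) (m∣m*n (q ^ b))
      2∣d : 2 ∣ d
      2∣d = subst (2 ∣_) (sym d≡PdA) (∣n⇒∣m*n P 2∣dA)
      2∤t : ¬ 2 ∣ t
      2∤t 2∣t = prime∤* prime[2] (∣dA⇒∤P prime[2] 2∣dA) (odd-^ c 2∤q)
                  (subst (2 ∣_) (trans t≡PtA (cong (P *_) tA≡q^c)) 2∣t)
      c≤b : c ≤ b
      c≤b = ^-reflects-≤-doubled (odd-prime≥3 pq 2∤q) (subst₂ _≤_ tA≡q^c dA≡2q^b tA≤dA)
      lcm∣2q^b : lcm dA tA ∣ 2 * q ^ b
      lcm∣2q^b = lcm-least (∣-reflexive dA≡2q^b)
                           (subst (_∣ 2 * q ^ b) (sym tA≡q^c) (∣n⇒∣m*n 2 (^-∣-mono q c≤b)))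
      dA≡2q^a : dA ≡ 2 * q ^ a
      dA≡2q^a = trans dA≡2q^b (cong (λ e → 2 * q ^ e)
                  (exponent-pinned (prime>1 pq) b≤a (*-cancelˡ-∣ 2 (subst (_∣ 2 * q ^ b) L lcm∣2q^b))))
      q∤2 : ¬ q ∣ 2
      q∤2 = prime∤prime pq prime[2] λ { refl → 2∤q ∣-refl }
      c<a : c < a
      c<a = ≤∧≢⇒< c≤a λ { refl →
        no-common-exact-power pq 0<a (trans dA≡2q^a (*-comm 2 (q ^ a))) (trans tA≡q^c (sym (*-identityʳ _)))
                              q∤2 (prime∤1 pq) }
      d≡2q^[a-c]t : d ≡ 2 * q ^ (a ∸ c) * t
      d≡2q^[a-c]t = begin
        d                                ≡⟨ d≡PdA ⟩
        P * dA                           ≡⟨ cong (P *_) dA≡2q^a ⟩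
        P * (2 * q ^ a)                  ≡⟨ x∙yz≈y∙xz P 2 (q ^ a) ⟩
        2 * (P * q ^ a)                  ≡⟨ cong (2 *_) (shift-exponent q c≤a) ⟩
        2 * (q ^ (a ∸ c) * (P * q ^ c))  ≡⟨ *-assoc 2 (q ^ (a ∸ c)) (P * q ^ c) ⟨
        2 * q ^ (a ∸ c) * (P * q ^ c)    ≡⟨ cong (λ x → 2 * q ^ (a ∸ c) * (P * x)) tA≡q^c ⟨
        2 * q ^ (a ∸ c) * (P * tA)       ≡⟨ cong (2 * q ^ (a ∸ c) *_) t≡PtA ⟨
        2 * q ^ (a ∸ c) * t              ∎

  -- (iii), case d_A = q ^ b, t_A = 2 q ^ c: d is odd, t even, c < b since
  -- t ≤ d, and the lcm forces b = a.
  odd-case : Prime q → ¬ 2 ∣ q → lcm dA tA ≡ 2 * q ^ a → b ≤ a →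
             dA ≡ q ^ b → tA ≡ 2 * q ^ c →
             (¬ 2 ∣ d × 2 ∣ t) × ∃[ x ] x < a × 2 * d ≡ q ^ (a ∸ x) * t
  odd-case {q} {a} {b} {c} pq 2∤q L b≤a dA≡q^b tA≡2q^c = (2∤d , 2∣t) , c , c<a , 2d≡q^[a-c]t
    where
      2∣tA : 2 ∣ tA
      2∣tA = subst (2 ∣_) (sym tA≡2q^c) (m∣m*n (q ^ c))
      2∣t : 2 ∣ t
      2∣t = subst (2 ∣_) (sym t≡PtA) (∣n⇒∣m*n P 2∣tA)
      2∤d : ¬ 2 ∣ d
      2∤d 2∣d = prime∤* prime[2] (∣tA⇒∤P prime[2] 2∣tA) (odd-^ b 2∤q)
                  (subst (2 ∣_) (trans d≡PdA (cong (P *_) dA≡q^b)) 2∣d)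
      c<b : c < b
      c<b = ^-reflects-<-halved {{prime⇒nonZero pq}} (subst₂ _≤_ tA≡2q^c dA≡q^b tA≤dA)
      lcm∣2q^b : lcm dA tA ∣ 2 * q ^ b
      lcm∣2q^b = lcm-least (subst (_∣ 2 * q ^ b) (sym dA≡q^b) (n∣m*n 2))
                           (subst (_∣ 2 * q ^ b) (sym tA≡2q^c) (*-monoʳ-∣ 2 (^-∣-mono q (<⇒≤ c<b))))
      b≡a : b ≡ a
      b≡a = exponent-pinned (prime>1 pq) b≤a (*-cancelˡ-∣ 2 (subst (_∣ 2 * q ^ b) L lcm∣2q^b))
      c<a : c < a
      c<a = subst (c <_) b≡a c<b
      2d≡q^[a-c]t : 2 * d ≡ q ^ (a ∸ c) * t
      2d≡q^[a-c]t = begin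
        2 * d                            ≡⟨ cong (2 *_) d≡PdA ⟩
        2 * (P * dA)                     ≡⟨ cong (λ x → 2 * (P * x)) (trans dA≡q^b (cong (q ^_) b≡a)) ⟩
        2 * (P * q ^ a)                  ≡⟨ cong (2 *_) (shift-exponent q (<⇒≤ c<a)) ⟩
        2 * (q ^ (a ∸ c) * (P * q ^ c))  ≡⟨ x∙yz≈y∙xz 2 (q ^ (a ∸ c)) (P * q ^ c) ⟩
        q ^ (a ∸ c) * (2 * (P * q ^ c))  ≡⟨ cong (q ^ (a ∸ c) *_) (x∙yz≈y∙xz 2 P (q ^ c)) ⟩
        q ^ (a ∸ c) * (P * (2 * q ^ c))  ≡⟨ cong (λ x → q ^ (a ∸ c) * (P * x)) tA≡2q^c ⟨
        q ^ (a ∸ c) * (P * tA)           ≡⟨ cong (q ^ (a ∸ c) *_) t≡PtA ⟨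
        q ^ (a ∸ c) * t                  ∎

  -- (iii) lcm(d_A, t_A) = 2 q ^ a: each of d_A, t_A is q ^ e or 2 q ^ e.  Both
  -- odd is impossible (the lcm would be odd); both even is impossible (2 ∈ A).
  part-iii : Prime q → ¬ 2 ∣ q → 0 < a → lcm dA tA ≡ 2 * q ^ a →
    (((2 ∣ d) × ¬ (2 ∣ t)) ⊎ (¬ (2 ∣ d) × (2 ∣ t)))
    × Σ ℕ (λ x → (x < a)
        × ((2 ∣ d) → d ≡ 2 * q ^ (a ∸ x) * t)
        × (¬ (2 ∣ d) → 2 * d ≡ q ^ (a ∸ x) * t))
  part-iii {q} {a} pq 2∤q 0<a L
    with ∣2*prime^⇒ a pq (subst (dA ∣_) L dA∣lcm) | ∣2*prime^⇒ a pq (subst (tA ∣_) L tA∣lcm)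
  ... | b , b≤a , inj₁ dA≡q^b | c , c≤a , inj₁ tA≡q^c =
    ⊥-elim (odd-^ a 2∤q (∣-trans (subst (2 ∣_) (sym L) (m∣m*n (q ^ a))) lcm∣q^a))
    where
      lcm∣q^a : lcm dA tA ∣ q ^ a
      lcm∣q^a = lcm-least (subst (_∣ q ^ a) (sym dA≡q^b) (^-∣-mono q b≤a))
                          (subst (_∣ q ^ a) (sym tA≡q^c) (^-∣-mono q c≤a))
  ... | b , b≤a , inj₂ dA≡2q^b | c , c≤a , inj₂ tA≡2q^c =
    ⊥-elim (no-common-exact-power {a = 1} {R = q ^ b} {S = q ^ c} prime[2] z<s dA≡2q^b tA≡2q^c
                                  (odd-^ b 2∤q) (odd-^ c 2∤q))
  ... | b , b≤a , inj₂ dA≡2q^b | c , c≤a , inj₁ tA≡q^c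
    with even-case {q} {a} {b} {c} pq 2∤q 0<a L b≤a c≤a dA≡2q^b tA≡q^c
  ...   | parity@(2∣d , _) , x , x<a , d≡2q^xt =
    inj₁ parity , x , x<a , (λ _ → d≡2q^xt) , λ 2∤d → ⊥-elim (2∤d 2∣d)
  part-iii {q} {a} pq 2∤q 0<a L
      | b , b≤a , inj₁ dA≡q^b | c , c≤a , inj₂ tA≡2q^c
    with odd-case {q} {a} {b} {c} pq 2∤q L b≤a dA≡q^b tA≡2q^c
  ...   | parity@(2∤d , _) , x , x<a , 2d≡q^xt =
    inj₂ parity , x , x<a , (λ 2∣d → ⊥-elim (2∤d 2∣d)) , λ _ → 2d≡q^xt

proposition4p11 : (d t dA tA : ℕ) → 0 < t → t ≤ d →
    IsMaxA d t d dA → IsMaxA d t t tA →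
    ((lcm dA tA ≡ 1 → d ≡ t)
    × ((q a : ℕ) → Prime q → 0 < a → lcm dA tA ≡ q ^ a →
        Σ ℕ (λ x → (x < a) × (d ≡ q ^ (a ∸ x) * t)))
    × ((q a : ℕ) → Prime q → ¬ (2 ∣ q) → 0 < a → lcm dA tA ≡ 2 * q ^ a →
        (((2 ∣ d) × ¬ (2 ∣ t)) ⊎ (¬ (2 ∣ d) × (2 ∣ t)))
        × Σ ℕ (λ x → (x < a)
            × ((2 ∣ d) → d ≡ 2 * q ^ (a ∸ x) * t)
            × (¬ (2 ∣ d) → 2 * d ≡ q ^ (a ∸ x) * t))))
proposition4p11 d t dA tA 0<t t≤d Md@((_ , goodD) , _) Mt@((_ , goodT) , _)
  with ExceptionalPrimes.common-cofactor d t (<-≤-trans 0<t t≤d) 0<t Md Mt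
... | P , d≡PdA , t≡PtA , primes-of-P =
  part-i , (λ q a → part-ii {q} {a}) , (λ q a → part-iii {q} {a})
  where open Decomposed 0<t t≤d d≡PdA t≡PtA goodD goodT primes-of-P
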